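{- Let $n,k\in\mathbb N$ with $n\ge 2k$. If $G$ is a graph with vertex set $[n]$ that does not contain a strongly non-nested $k$-matching, then $$|\{xy\in E(G):|x-y|\le k-1\}|\le 2(k-1)^2.$$
   Context: $G$ is viewed as an ordered graph on $[n]$ with the natural order. Two vertex-disjoint edges $xy$, $uv$ with $x<y$, $u<v$ are separated if $[x,y]\cap[u,v]=\emptyset$; nested if one of these intervals contains the other; crossing otherwise. A $k$-matching is a set of $k$ pairwise vertex-disjoint edges; it is crossing if every pair of its edges crosses. A $k$-matching is strongly non-nested if it is a disjoint union of crossing matchings such that two of its edges cross if and only if they belong to the same one of these crossing matchings (edges in different parts being separated). -}

module Defs where

open import Data.Nat using (ℕ; _<_; _≤_; _∸_; _<ᵇ_; _≤ᵇ_)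
open import Data.Bool using (Bool; true; false; _∧_)
open import Data.Fin using (Fin; toℕ)
open import Data.List using (List; length; filterᵇ; concatMap; map; allFin)
open import Data.Product using (_×_; _,_; proj₁; proj₂; Σ)
open import Data.Sum using (_⊎_)
open import Relation.Binary.PropositionalEquality using (_≡_; _≢_)

-- A simple graph on the vertex set [n], represented by Fin n
-- (vertex i ∈ Fin n stands for i+1 ∈ [n]; the order is the natural one).
record Graph (n : ℕ) : Set where
  field
    adj     : Fin n → Fin n → Bool
    adj-sym : ∀ x y → adj x y ≡ adj y x
    irrefl  : ∀ x → adj x x ≡ false
open Graph public

Pair : ℕ → Set
Pair n = Fin n × Fin n

lo hi : ∀ {n} → Pair n → ℕ
lo e = toℕ (proj₁ e)
hi e = toℕ (proj₂ e)

Disjoint : ∀ {n} → Pair n → Pair n → Set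
Disjoint (x , y) (u , v) = x ≢ u × x ≢ v × y ≢ u × y ≢ v

Separated : ∀ {n} → Pair n → Pair n → Set
Separated e f = hi e < lo f ⊎ hi f < lo e

Nested : ∀ {n} → Pair n → Pair n → Set
Nested e f = (lo e < lo f × hi f < hi e) ⊎ (lo f < lo e × hi e < hi f)

-- crossing: neither separated nor nested (for disjoint edges this is
-- x < u < y < v or u < x < v < y)
Crossing : ∀ {n} → Pair n → Pair n → Set
Crossing e f = (lo e < lo f × lo f < hi e × hi e < hi f)
             ⊎ (lo f < lo e × lo e < hi f × hi f < hi e)

record Matching {n : ℕ} (G : Graph n) (k : ℕ) : Set where
  field
    edge     : Fin k → Pair n
    ordered  : ∀ i → lo (edge i) < hi (edge i)
    inG      : ∀ i → adj G (proj₁ (edge i)) (proj₂ (edge i)) ≡ true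
    disjoint : ∀ i j → i ≢ j → Disjoint (edge i) (edge j)
open Matching public

-- Strongly non-nested: a partition of the edges into parts (given by a
-- labelling), each part a crossing matching, such that two distinct edges
-- cross iff they lie in the same part, and edges in different parts are
-- separated.
StronglyNonNested : ∀ {n k} {G : Graph n} → Matching G k → Set
StronglyNonNested {k = k} M =
  Σ (Fin k → Fin k) λ part →
    (∀ i j → i ≢ j → part i ≡ part j → Crossing (edge M i) (edge M j))
  × (∀ i j → part i ≢ part j → Separated (edge M i) (edge M j))

ContainsSNNMatching : ∀ {n} → Graph n → ℕ → Set
ContainsSNNMatching G k = Σ (Matching G k) StronglyNonNested

shortEdgeCount : ∀ {n} → Graph n → ℕ → ℕ
shortEdgeCount {n} G k =
  length (filterᵇ (λ e → (lo e <ᵇ hi e) ∧ adj G (proj₁ e) (proj₂ e) ∧ (hi e ∸ lo e ≤ᵇ k ∸ 1))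
                  (concatMap (λ x → map (x ,_) (allFin n)) (allFin n)))

-- Sort the short edges into 2(k − 1) classes: an edge xy (x < y) has length
-- d = y − x ∈ [1, k − 1], and we cut [n] into consecutive blocks of size d and
-- record the parity of the block containing x.  Two edges of one class cross
-- when their left endpoints lie in the same block, and are separated otherwise,
-- because two distinct blocks of the same parity are at least d apart.  Hence
-- any k edges of one class form a strongly non-nested matching (its parts being
-- the blocks), so each class has at most k − 1 edges.
module Submission where

open import Defs
open import Data.Nat using (ℕ; _≤_; _*_; _∸_)
open import Relation.Nullary using (¬_)

open import Data.Nat
  using (zero; suc; _+_; _<_; _<ᵇ_; _≤ᵇ_; _≡ᵇ_; z≤n; s≤s; NonZero; _/_; _%_; _≤?_; parity)
open import Data.Nat.Properties
open import Data.Nat.DivMod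
  using (m≡m%n+[m/n]*n; m%n<n; m/n*n≤m; /-monoˡ-≤; [m+kn]%n≡m%n; m<n⇒m%n≡m)
open import Data.Parity.Base using (Parity; 0ℙ; 1ℙ)
open import Data.Parity.Properties using (p≢p⁻¹; suc-homo-⁻¹)
open import Data.Bool using (Bool; true; false; _∧_; T)
open import Data.Bool.Properties using (T-∧; T-≡)
open import Data.Fin using (Fin; toℕ; inject≤)
import Data.Fin as Fin
open import Data.Fin.Properties using (toℕ<n; toℕ-injective; toℕ-inject≤; any?)
open import Data.List
  using (List; []; _∷_; length; filterᵇ; concatMap; map; allFin; lookup; cartesianProduct; _++_)
open import Data.List.Relation.Unary.Unique.Propositional using (Unique)
import Data.List.Relation.Unary.Unique.Propositional.Properties as Unique
import Data.List.Relation.Unary.All as All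
open import Data.List.Relation.Unary.AllPairs using (_∷_)
open import Data.List.Membership.Propositional using (_∈_)
open import Data.List.Membership.Propositional.Properties using (∈-filter⁻; ∈-lookup)
open import Data.Product using (_×_; _,_; proj₁; proj₂; Σ)
open import Data.Sum using (inj₁; inj₂; swap)
open import Function using (_∘_)
open import Function.Bundles using (Equivalence)
open import Function.Definitions using (Injective)
open import Relation.Nullary using (yes; no; contradiction)
open import Relation.Nullary.Decidable using (T?)
open import Relation.Binary using (tri<; tri≈; tri>)
open import Relation.Binary.PropositionalEquality
open import Algebra.Properties.CommutativeMonoid.Sum +-0-commutativeMonoid
  using (sum-syntax; sum-cong-≗; ∑-distrib-+)

module _ {A : Set} where

  count : (A → Bool) → List A → ℕ
  count p xs = length (filterᵇ p xs)

  indicator : Bool → ℕ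
  indicator false = 0
  indicator true  = 1

  count-∷ : ∀ (p : A → Bool) x xs → count p (x ∷ xs) ≡ indicator (p x) + count p xs
  count-∷ p x xs with p x
  ... | true  = refl
  ... | false = refl

  fibre : (A → Bool) → (A → ℕ) → ℕ → A → Bool
  fibre p f c x = p x ∧ (f x ≡ᵇ c)

  T-fibre : ∀ {p f c x} → T (fibre p f c x) → T (p x) × f x ≡ c
  T-fibre {f = f} {c} {x} t with Equivalence.to T-∧ t
  ... | px , fx≡ᵇc = px , ≡ᵇ⇒≡ (f x) c fx≡ᵇc

  1≤∑-indicator-≡ᵇ : ∀ {m v} → v < m → 1 ≤ ∑[ c < m ] indicator (v ≡ᵇ toℕ c)
  1≤∑-indicator-≡ᵇ {suc m} {zero}  _         = s≤s z≤n
  1≤∑-indicator-≡ᵇ {suc m} {suc v} (s≤s v<m) = 1≤∑-indicator-≡ᵇ v<m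

  ∑-≤ : ∀ m (g : Fin m → ℕ) {B} → (∀ c → g c ≤ B) → ∑[ c < m ] g c ≤ m * B
  ∑-≤ zero    g g≤B = z≤n
  ∑-≤ (suc m) g g≤B = +-mono-≤ (g≤B Fin.zero) (∑-≤ m (g ∘ Fin.suc) (g≤B ∘ Fin.suc))

  module _ (p : A → Bool) (f : A → ℕ) {m} (f<m : ∀ x → T (p x) → f x < m) where

    indicator≤∑-fibres : ∀ x → indicator (p x) ≤ ∑[ c < m ] indicator (fibre p f (toℕ c) x)
    indicator≤∑-fibres x with p x | f<m x
    ... | true  | fx<m = 1≤∑-indicator-≡ᵇ (fx<m _)
    ... | false | _    = z≤n

    count≤∑-fibres : ∀ xs → count p xs ≤ ∑[ c < m ] count (fibre p f (toℕ c)) xs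
    count≤∑-fibres []       = z≤n
    count≤∑-fibres (x ∷ xs) = begin
      count p (x ∷ xs)
        ≡⟨ count-∷ p x xs ⟩
      indicator (p x) + count p xs
        ≤⟨ +-mono-≤ (indicator≤∑-fibres x) (count≤∑-fibres xs) ⟩
      ∑[ c < m ] indicator (fibre p f (toℕ c) x) + ∑[ c < m ] count (fibre p f (toℕ c)) xs
        ≡⟨ ∑-distrib-+ {m} (λ c → indicator (fibre p f (toℕ c) x))
                           (λ c → count (fibre p f (toℕ c)) xs) ⟨
      ∑[ c < m ] (indicator (fibre p f (toℕ c) x) + count (fibre p f (toℕ c)) xs)
        ≡⟨ sum-cong-≗ {m} (λ c → count-∷ (fibre p f (toℕ c)) x xs) ⟨
      ∑[ c < m ] count (fibre p f (toℕ c)) (x ∷ xs) ∎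
      where open ≤-Reasoning

    pigeonhole : ∀ {B} xs → (∀ c → c < m → count (fibre p f c) xs ≤ B) → count p xs ≤ m * B
    pigeonhole xs fibre≤B = ≤-trans (count≤∑-fibres xs) (∑-≤ m _ (λ c → fibre≤B (toℕ c) (toℕ<n c)))

lookup-injective : ∀ {A : Set} {ys : List A} → Unique ys → ∀ {i j} → lookup ys i ≡ lookup ys j → i ≡ j
lookup-injective (_   ∷ _) {Fin.zero}  {Fin.zero}  _  = refl
lookup-injective (y∉ ∷ _) {Fin.zero}  {Fin.suc j} eq = contradiction eq (All.lookup y∉ (∈-lookup j))
lookup-injective (y∉ ∷ _) {Fin.suc i} {Fin.zero}  eq = contradiction (sym eq) (All.lookup y∉ (∈-lookup i))
lookup-injective (_  ∷ u) {Fin.suc i} {Fin.suc j} eq = cong Fin.suc (lookup-injective u eq)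

distinct-members : ∀ {A : Set} {ys : List A} {k} → Unique ys → k ≤ length ys →
                   Σ (Fin k → A) λ f → Injective _≡_ _≡_ f × (∀ i → f i ∈ ys)
distinct-members {A} {ys} {k} u k≤ys = f , f-injective , λ i → ∈-lookup (inject≤ i k≤ys)
  where
    f : Fin k → A
    f i = lookup ys (inject≤ i k≤ys)
    f-injective : Injective _≡_ _≡_ f
    f-injective {i} {j} eq = toℕ-injective (begin
      toℕ i                ≡⟨ toℕ-inject≤ i k≤ys ⟨
      toℕ (inject≤ i k≤ys) ≡⟨ cong toℕ (lookup-injective u eq) ⟩
      toℕ (inject≤ j k≤ys) ≡⟨ toℕ-inject≤ j k≤ys ⟩
      toℕ j                ∎)
      where open ≡-Reasoning

concatMap≡cartesianProduct : ∀ {A B : Set} (xs : List A) (ys : List B) →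
                             concatMap (λ x → map (x ,_) ys) xs ≡ cartesianProduct xs ys
concatMap≡cartesianProduct []       ys = refl
concatMap≡cartesianProduct (x ∷ xs) ys = cong (map (x ,_) ys ++_) (concatMap≡cartesianProduct xs ys)

allPairs : ∀ n → List (Pair n)
allPairs n = concatMap (λ x → map (x ,_) (allFin n)) (allFin n)

allPairs-unique : ∀ n → Unique (allPairs n)
allPairs-unique n = subst Unique (sym (concatMap≡cartesianProduct (allFin n) (allFin n)))
                          (Unique.cartesianProduct⁺ (Unique.allFin⁺ n) (Unique.allFin⁺ n))

module _ {k} (g : Fin k → ℕ) where

  search : ℕ → Fin k → Fin k
  search v default with any? (λ j → g j ≟ v)
  ... | yes (j , _) = j
  ... | no  _       = default

  search-spec : ∀ {v d} → g d ≡ v → g (search v d) ≡ v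
  search-spec {v} gd≡v with any? (λ j → g j ≟ v)
  ... | yes (_ , gj≡v) = gj≡v
  ... | no  _          = gd≡v

  search-default-irrelevant : ∀ {v} d {d'} → g d' ≡ v → search v d ≡ search v d'
  search-default-irrelevant {v} d {d'} gd'≡v with any? (λ j → g j ≟ v)
  ... | yes _ = refl
  ... | no ∄  = contradiction (d' , gd'≡v) ∄

  representative : Fin k → Fin k
  representative i = search (g i) i

  representative-cong : ∀ {i j} → g i ≡ g j → representative i ≡ representative j
  representative-cong {i} {j} gi≡gj rewrite gi≡gj = search-default-irrelevant i refl

  representative-injective : ∀ {i j} → representative i ≡ representative j → g i ≡ g j
  representative-injective {i} {j} eq = begin
    g i                  ≡⟨ search-spec refl ⟨
    g (representative i) ≡⟨ cong g eq ⟩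
    g (representative j) ≡⟨ search-spec refl ⟩
    g j                  ∎
    where open ≡-Reasoning

parity-suc : ∀ q → parity (suc q) ≢ parity q
parity-suc q eq = p≢p⁻¹ (parity (suc q)) (trans eq (sym (suc-homo-⁻¹ q)))

same-parity⇒2+≤ : ∀ {q q'} → q < q' → parity q ≡ parity q' → 2 + q ≤ q'
same-parity⇒2+≤ {q} q<q' par =
  ≤∧≢⇒< q<q' (λ q+1≡q' → parity-suc q (trans (cong parity q+1≡q') (sym par)))

module _ (s : ℕ) .{{_ : NonZero s}} where

  a<[1+a/s]*s : ∀ a → a < suc (a / s) * s
  a<[1+a/s]*s a = begin-strict
    a                 ≡⟨ m≡m%n+[m/n]*n a s ⟩
    a % s + a / s * s <⟨ +-monoˡ-< (a / s * s) (m%n<n a s) ⟩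
    s + a / s * s     ∎
    where open ≤-Reasoning

  same-block⇒< : ∀ {a b} → a / s ≡ b / s → b < a + s
  same-block⇒< {a} {b} eq = begin-strict
    b                   <⟨ a<[1+a/s]*s b ⟩
    suc (b / s) * s     ≡⟨ cong (λ q → suc q * s) eq ⟨
    s + a / s * s       ≤⟨ +-monoʳ-≤ s (m/n*n≤m a s) ⟩
    s + a               ≡⟨ +-comm s a ⟩
    a + s               ∎
    where open ≤-Reasoning

  distinct-blocks-of-same-parity⇒< : ∀ {a b} → a ≤ b → parity (a / s) ≡ parity (b / s) → a / s ≢ b / s →
                                     a + s < b
  distinct-blocks-of-same-parity⇒< {a} {b} a≤b par ne = begin-strict
    a + s                 <⟨ +-monoˡ-< s (a<[1+a/s]*s a) ⟩
    suc (a / s) * s + s   ≡⟨ +-comm (suc (a / s) * s) s ⟩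
    (2 + a / s) * s       ≤⟨ *-monoˡ-≤ s (same-parity⇒2+≤ (≤∧≢⇒< (/-monoˡ-≤ s a≤b) ne) par) ⟩
    b / s * s             ≤⟨ m/n*n≤m b s ⟩
    b                     ∎
    where open ≤-Reasoning

suc[n∸m∸1]≡n∸m : ∀ {m n} → m < n → suc (n ∸ m ∸ 1) ≡ n ∸ m
suc[n∸m∸1]≡n∸m {zero}  {suc n} _         = refl
suc[n∸m∸1]≡n∸m {suc m} {suc n} (s≤s m<n) = suc[n∸m∸1]≡n∸m m<n

bit : Parity → ℕ
bit 0ℙ = 0
bit 1ℙ = 1

bit<2 : ∀ p → bit p < 2
bit<2 0ℙ = s≤s z≤n
bit<2 1ℙ = s≤s (s≤s z≤n)

bit-injective : ∀ {p q} → bit p ≡ bit q → p ≡ q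
bit-injective {0ℙ} {0ℙ} _ = refl
bit-injective {1ℙ} {1ℙ} _ = refl

bit+*2-injective : ∀ {p q} m n → bit p + m * 2 ≡ bit q + n * 2 → p ≡ q × m ≡ n
bit+*2-injective {p} {q} m n eq = bit-injective bp≡bq , *-cancelʳ-≡ m n 2 (+-cancelˡ-≡ (bit p) _ _ eq')
  where
    bit≡%2 : ∀ r l → bit r ≡ (bit r + l * 2) % 2
    bit≡%2 r l = sym (trans ([m+kn]%n≡m%n (bit r) l 2) (m<n⇒m%n≡m (bit<2 r)))
    bp≡bq : bit p ≡ bit q
    bp≡bq = trans (bit≡%2 p m) (trans (cong (_% 2) eq) (sym (bit≡%2 q n)))
    eq' : bit p + m * 2 ≡ bit p + n * 2
    eq' = trans eq (cong (λ b → b + n * 2) (sym bp≡bq))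

module _ {n : ℕ} where

  -- gap e is the length minus one, so that the block size suc (gap e) is visibly nonzero.
  gap : Pair n → ℕ
  gap e = hi e ∸ lo e ∸ 1

  block : Pair n → ℕ
  block e = lo e / suc (gap e)

  label : Pair n → ℕ
  label e = bit (parity (block e)) + gap e * 2

  SameClass : Pair n → Pair n → Set
  SameClass e f = gap e ≡ gap f × parity (block e) ≡ parity (block f)

  label-injective : ∀ {e f} → label e ≡ label f → SameClass e f
  label-injective {e} {f} eq with bit+*2-injective (gap e) (gap f) eq
  ... | par , gap≡ = gap≡ , par

  hi≡lo+suc-gap : ∀ {e} → lo e < hi e → hi e ≡ lo e + suc (gap e)
  hi≡lo+suc-gap {e} lo<hi =
    trans (sym (m+[n∸m]≡n (<⇒≤ lo<hi))) (cong (lo e +_) (sym (suc[n∸m∸1]≡n∸m lo<hi)))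

  CrossesIffSameBlock : Pair n → Pair n → Set
  CrossesIffSameBlock e f = (block e ≡ block f → Crossing e f) × (block e ≢ block f → Separated e f)

  CrossesIffSameBlock-sym : ∀ {e f} → CrossesIffSameBlock e f → CrossesIffSameBlock f e
  CrossesIffSameBlock-sym (cross , sep) = (λ eq → swap (cross (sym eq))) , (λ ne → swap (sep (ne ∘ sym)))

  sameClass-lo<⇒crossesIffSameBlock : ∀ {e f} → lo e < hi e → lo f < hi f → SameClass e f →
                                      lo e < lo f → CrossesIffSameBlock e f
  sameClass-lo<⇒crossesIffSameBlock {e} {f} ordᵉ ordᶠ (gap≡ , par) lo< = crossing , separated
    where
      s : ℕ
      s = suc (gap e)
      hiᵉ : hi e ≡ lo e + s
      hiᵉ = hi≡lo+suc-gap ordᵉ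
      hiᶠ : hi f ≡ lo f + s
      hiᶠ = trans (hi≡lo+suc-gap ordᶠ) (cong (λ g → lo f + suc g) (sym gap≡))
      blockᶠ : block f ≡ lo f / s
      blockᶠ = cong (λ g → lo f / suc g) (sym gap≡)

      crossing : block e ≡ block f → Crossing e f
      crossing eq = inj₁ ( lo<
                         , subst (lo f <_) (sym hiᵉ) (same-block⇒< s (trans eq blockᶠ))
                         , subst₂ _<_ (sym hiᵉ) (sym hiᶠ) (+-monoˡ-< s lo<))

      separated : block e ≢ block f → Separated e f
      separated ne = inj₁ (subst (_< lo f) (sym hiᵉ)
        (distinct-blocks-of-same-parity⇒< s (<⇒≤ lo<) (trans par (cong parity blockᶠ))
                                           (ne ∘ λ eq → trans eq (sym blockᶠ))))

  sameClass⇒crossesIffSameBlock : ∀ {e f} → lo e < hi e → lo f < hi f → SameClass e f → e ≢ f →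
                                  CrossesIffSameBlock e f
  sameClass⇒crossesIffSameBlock {e} {f} ordᵉ ordᶠ same@(gap≡ , par) e≢f with <-cmp (lo e) (lo f)
  ... | tri< lo< _ _ = sameClass-lo<⇒crossesIffSameBlock ordᵉ ordᶠ same lo<
  ... | tri> _ _ lo> =
    CrossesIffSameBlock-sym (sameClass-lo<⇒crossesIffSameBlock ordᶠ ordᵉ (sym gap≡ , sym par) lo>)
  ... | tri≈ _ lo≡ _ = contradiction (cong₂ _,_ (toℕ-injective lo≡) (toℕ-injective hi≡)) e≢f
    where
      hi≡ : hi e ≡ hi f
      hi≡ = trans (hi≡lo+suc-gap ordᵉ)
                  (trans (cong₂ (λ l g → l + suc g) lo≡ gap≡) (sym (hi≡lo+suc-gap ordᶠ)))

  toℕ-disjoint : ∀ {x y u v : Fin n} → toℕ x ≢ toℕ u → toℕ x ≢ toℕ v → toℕ y ≢ toℕ u → toℕ y ≢ toℕ v →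
                 Disjoint (x , y) (u , v)
  toℕ-disjoint xu xv yu yv = xu ∘ cong toℕ , xv ∘ cong toℕ , yu ∘ cong toℕ , yv ∘ cong toℕ

  Disjoint-sym : ∀ {e f : Pair n} → Disjoint e f → Disjoint f e
  Disjoint-sym (xu , xv , yu , yv) = xu ∘ sym , yu ∘ sym , xv ∘ sym , yv ∘ sym

  crossing⇒disjoint : ∀ {e f} → Crossing e f → Disjoint e f
  crossing⇒disjoint (inj₁ (a<b , b<c , c<d)) =
    toℕ-disjoint (<⇒≢ a<b) (<⇒≢ (<-trans a<b (<-trans b<c c<d))) (>⇒≢ b<c) (<⇒≢ c<d)
  crossing⇒disjoint {e} {f} (inj₂ cross) = Disjoint-sym {f} {e} (crossing⇒disjoint (inj₁ cross))

  separated⇒disjoint : ∀ {e f} → lo e < hi e → lo f < hi f → Separated e f → Disjoint e f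
  separated⇒disjoint ordᵉ ordᶠ (inj₁ c<b) =
    toℕ-disjoint (<⇒≢ (<-trans ordᵉ c<b)) (<⇒≢ (<-trans ordᵉ (<-trans c<b ordᶠ)))
                 (<⇒≢ c<b) (<⇒≢ (<-trans c<b ordᶠ))
  separated⇒disjoint {e} {f} ordᵉ ordᶠ (inj₂ sep) =
    Disjoint-sym {f} {e} (separated⇒disjoint ordᶠ ordᵉ (inj₁ sep))

  crossesIffSameBlock⇒disjoint : ∀ {e f} → lo e < hi e → lo f < hi f → CrossesIffSameBlock e f → Disjoint e f
  crossesIffSameBlock⇒disjoint {e} {f} ordᵉ ordᶠ (cross , sep) with block e ≟ block f
  ... | yes eq = crossing⇒disjoint (cross eq)
  ... | no  ne = separated⇒disjoint ordᵉ ordᶠ (sep ne)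

  sameClass⇒snn : ∀ {G : Graph n} {k} (ed : Fin k → Pair n) → Injective _≡_ _≡_ ed →
                  (∀ i → lo (ed i) < hi (ed i)) → (∀ i → adj G (proj₁ (ed i)) (proj₂ (ed i)) ≡ true) →
                  (∀ i j → SameClass (ed i) (ed j)) → ContainsSNNMatching G k
  sameClass⇒snn {G} {k} ed ed-injective ord inG same = M , part , cross , sep
    where
      related : ∀ i j → i ≢ j → CrossesIffSameBlock (ed i) (ed j)
      related i j i≢j = sameClass⇒crossesIffSameBlock (ord i) (ord j) (same i j) (i≢j ∘ ed-injective)

      M : Matching G k
      M = record
        { edge     = ed
        ; ordered  = ord
        ; inG      = inG
        ; disjoint = λ i j i≢j → crossesIffSameBlock⇒disjoint (ord i) (ord j) (related i j i≢j)
        }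

      part : Fin k → Fin k
      part = representative (block ∘ ed)

      cross : ∀ i j → i ≢ j → part i ≡ part j → Crossing (ed i) (ed j)
      cross i j i≢j eq = proj₁ (related i j i≢j) (representative-injective (block ∘ ed) eq)

      sep : ∀ i j → part i ≢ part j → Separated (ed i) (ed j)
      sep i j ne = proj₂ (related i j (ne ∘ cong part)) (ne ∘ representative-cong (block ∘ ed))

module _ {n} (G : Graph n) (k : ℕ) where

  short : Pair n → Bool
  short e = (lo e <ᵇ hi e) ∧ adj G (proj₁ e) (proj₂ e) ∧ (hi e ∸ lo e ≤ᵇ k ∸ 1)

  T-short : ∀ {e} → T (short e) → lo e < hi e × adj G (proj₁ e) (proj₂ e) ≡ true × hi e ∸ lo e ≤ k ∸ 1
  T-short {e} t with Equivalence.to T-∧ t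
  ... | ordered , t' with Equivalence.to T-∧ t'
  ... | inG , span = <ᵇ⇒< (lo e) (hi e) ordered , Equivalence.to T-≡ inG , ≤ᵇ⇒≤ (hi e ∸ lo e) (k ∸ 1) span

  label<2[k∸1] : ∀ e → T (short e) → label e < 2 * (k ∸ 1)
  label<2[k∸1] e t = begin-strict
    bit (parity (block e)) + gap e * 2 <⟨ +-monoˡ-< (gap e * 2) (bit<2 (parity (block e))) ⟩
    suc (gap e) * 2                    ≤⟨ *-monoˡ-≤ 2 (subst (_≤ k ∸ 1) (sym (suc[n∸m∸1]≡n∸m lo<hi)) span≤) ⟩
    (k ∸ 1) * 2                        ≡⟨ *-comm (k ∸ 1) 2 ⟩
    2 * (k ∸ 1)                        ∎
    where
      open ≤-Reasoning
      lo<hi : lo e < hi e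
      lo<hi = proj₁ (T-short {e} t)
      span≤ : hi e ∸ lo e ≤ k ∸ 1
      span≤ = proj₂ (proj₂ (T-short {e} t))

  large-class⇒snn : ∀ c → k ≤ count (fibre short label c) (allPairs n) → ContainsSNNMatching G k
  large-class⇒snn c k≤ with distinct-members (Unique.filter⁺ (T? ∘ fibre short label c) (allPairs-unique n)) k≤
  ... | ed , ed-injective , ed∈ =
    sameClass⇒snn ed ed-injective (proj₁ ∘ short-ed) (proj₁ ∘ proj₂ ∘ short-ed) same
    where
      in-class : ∀ i → T (short (ed i)) × label (ed i) ≡ c
      in-class i = T-fibre {p = short} {f = label} {x = ed i}
                     (proj₂ (∈-filter⁻ (T? ∘ fibre short label c) {xs = allPairs n} (ed∈ i)))
      short-ed : ∀ i → lo (ed i) < hi (ed i) × adj G (proj₁ (ed i)) (proj₂ (ed i)) ≡ true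
                     × hi (ed i) ∸ lo (ed i) ≤ k ∸ 1
      short-ed i = T-short (proj₁ (in-class i))
      same : ∀ i j → SameClass (ed i) (ed j)
      same i j = label-injective {e = ed i} {f = ed j} (trans (proj₂ (in-class i)) (sym (proj₂ (in-class j))))

  class-size≤k∸1 : ¬ ContainsSNNMatching G k → ∀ c → count (fibre short label c) (allPairs n) ≤ k ∸ 1
  class-size≤k∸1 no-snn c with count (fibre short label c) (allPairs n) ≤? k ∸ 1
  ... | yes ≤k∸1 = ≤k∸1
  ... | no  ≰k∸1 = contradiction (large-class⇒snn c (≤-trans (m≤n+m∸n k 1) (≰⇒> ≰k∸1))) no-snn

lemma2p5 : (n k : ℕ) → 2 * k ≤ n → (G : Graph n) → ¬ ContainsSNNMatching G k → shortEdgeCount G k ≤ 2 * ((k ∸ 1) * (k ∸ 1))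
lemma2p5 n k _ G no-snn = begin
  shortEdgeCount G k      ≤⟨ pigeonhole (short G k) label (label<2[k∸1] G k) (allPairs n) (λ c _ → class-size≤k∸1 G k no-snn c) ⟩
  2 * (k ∸ 1) * (k ∸ 1)   ≡⟨ *-assoc 2 (k ∸ 1) (k ∸ 1) ⟩
  2 * ((k ∸ 1) * (k ∸ 1)) ∎
  where open ≤-Reasoning
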